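{- $\mathsf{TC}_1$ proves, for all atoms $a,b$ and all $x,y$: (i) if $x*a=y*b$ then $x=y$ and $a=b$; (ii) if $a*x=b*y$ then $a=b$ and $x=y$.
   Context: $\mathsf{TC}_1$ is the theory in the language with a constant $\varnothing$ and binary function $*$, axiomatised by: $\varnothing*x=x\wedge x*\varnothing=x$; $x*y=\varnothing\to(x=\varnothing\wedge y=\varnothing)$; $(x*y)*z=x*(y*z)$; and $x*y=u*v\to\exists w\,((x*w=u\wedge y=w*v)\vee(x=u*w\wedge w*y=v))$. An atom is an $a\neq\varnothing$ such that for all $x,y$, if $x*y=a$ then $x=\varnothing$ or $y=\varnothing$. -}

module Defs where

open import Level using (Level; suc)
open import Relation.Binary.PropositionalEquality using (_≡_)
open import Relation.Nullary using (¬_)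
open import Data.Product using (_×_; ∃-syntax)
open import Data.Sum using (_⊎_)

record TC₁-Model (ℓ : Level) : Set (suc ℓ) where
  infixl 6 _*_
  field
    Carrier : Set ℓ
    ∅       : Carrier
    _*_     : Carrier → Carrier → Carrier
    idˡ     : ∀ x → ∅ * x ≡ x
    idʳ     : ∀ x → x * ∅ ≡ x
    noZeroDiv : ∀ x y → x * y ≡ ∅ → (x ≡ ∅ × y ≡ ∅)
    assoc   : ∀ x y z → (x * y) * z ≡ x * (y * z)
    editor  : ∀ x y u v → x * y ≡ u * v →
              ∃[ w ] ((x * w ≡ u × y ≡ w * v) ⊎ (x ≡ u * w × w * y ≡ v))

  IsAtom : Carrier → Set ℓ
  IsAtom a = ¬ (a ≡ ∅) × (∀ x y → x * y ≡ a → (x ≡ ∅ ⊎ y ≡ ∅))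

{-# OPTIONS --safe #-}
module Submission where

open import Defs
open import Level using (Level)
open import Function using (_∘_; flip)
open import Relation.Binary.PropositionalEquality using (_≡_; _≢_; refl; sym; trans)
open import Relation.Nullary using (contradiction)
open import Data.Product as Product using (_×_; _,_; proj₁; swap)
open import Data.Sum as Sum using (inj₁; inj₂)

-- The editor axiom splits x * a = y * b at a common refinement w; since a and b
-- are atoms, w must be ∅.  The left-hand statement is the right-hand one in the
-- opposite model, as the axioms of TC₁ are invariant under reversing products.

module _ {ℓ : Level} (M : TC₁-Model ℓ) where
  open TC₁-Model M

  atom-right-factor : ∀ {a b w} → IsAtom a → b ≢ ∅ → w * b ≡ a → w ≡ ∅
  atom-right-factor (_ , indecomposable) b≢∅ wb≡a with indecomposable _ _ wb≡a
  ... | inj₁ w≡∅ = w≡∅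
  ... | inj₂ b≡∅ = contradiction b≡∅ b≢∅

  cancel-through-atom : ∀ {a b x y w} → IsAtom a → b ≢ ∅ →
                        x * w ≡ y → a ≡ w * b → x ≡ y × a ≡ b
  cancel-through-atom atom-a b≢∅ xw≡y a≡wb
    with refl ← atom-right-factor atom-a b≢∅ (sym a≡wb)
    = trans (sym (idʳ _)) xw≡y , trans a≡wb (idˡ _)

  atom-right-cancel : ∀ {a b x y} → IsAtom a → IsAtom b →
                      x * a ≡ y * b → x ≡ y × a ≡ b
  atom-right-cancel atom-a atom-b xa≡yb with editor _ _ _ _ xa≡yb
  ... | _ , inj₁ (xw≡y , a≡wb) =
    cancel-through-atom atom-a (proj₁ atom-b) xw≡y a≡wb
  ... | _ , inj₂ (x≡yw , wa≡b) =
    Product.map sym sym (cancel-through-atom atom-b (proj₁ atom-a) (sym x≡yw) (sym wa≡b))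

opposite : ∀ {ℓ} → TC₁-Model ℓ → TC₁-Model ℓ
opposite M = record
  { Carrier   = Carrier
  ; ∅         = ∅
  ; _*_       = flip _*_
  ; idˡ       = idʳ
  ; idʳ       = idˡ
  ; noZeroDiv = λ x y yx≡∅ → swap (noZeroDiv y x yx≡∅)
  ; assoc     = λ x y z → sym (assoc z y x)
  ; editor    = λ x y u v yx≡vu →
                  Product.map₂ (Sum.swap ∘ Sum.map swap swap) (editor y x v u yx≡vu)
  }
  where open TC₁-Model M

module _ {ℓ : Level} (M : TC₁-Model ℓ) where
  open TC₁-Model M

  atom-opposite : ∀ {a} → IsAtom a → TC₁-Model.IsAtom (opposite M) a
  atom-opposite = Product.map₂ (λ indecomposable x y yx≡a → Sum.swap (indecomposable y x yx≡a))

  atom-left-cancel : ∀ {a b x y} → IsAtom a → IsAtom b →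
                     a * x ≡ b * y → a ≡ b × x ≡ y
  atom-left-cancel atom-a atom-b =
    swap ∘ atom-right-cancel (opposite M) (atom-opposite atom-a) (atom-opposite atom-b)

mainTheorem16 : ∀ {ℓ : Level} (M : TC₁-Model ℓ) → let open TC₁-Model M in
    ∀ (a b x y : Carrier) → IsAtom a → IsAtom b →
      (x * a ≡ y * b → (x ≡ y × a ≡ b)) × (a * x ≡ b * y → (a ≡ b × x ≡ y))
mainTheorem16 M a b x y atom-a atom-b =
  atom-right-cancel M atom-a atom-b , atom-left-cancel M atom-a atom-b
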